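{- Let $\mathbf{L}$ be an intermediate logic, let $\mathbf{LJL}_0\in\{\mathbf{LJ}_0,\mathbf{LJT}_0,\mathbf{LJ4}_0,\mathbf{LJT4}_0\}$ and let $CS$ be a constant specification for $\mathbf{LJL}_0$. Let $Th_{\mathbf{LJL}_{CS}}:=\{\psi\in\mathcal{L}_J\mid \emptyset\vdash_{\mathbf{LJL}_{CS}}\psi\}$. Then for all $\Gamma\cup\{\phi\}\subseteq\mathcal{L}_J$: \[ \Gamma\vdash_{\mathbf{LJL}_{CS}}\phi\quad\text{iff}\quad \Gamma^\star\cup(Th_{\mathbf{LJL}_{CS}})^\star\vdash_{\mathbf{L}^\star}\phi^\star . \]
   Context: Let $Var=\{p_i\mid i\in\mathbb{N}\}$ and let $\mathcal{L}_0$ be the set of formulas built from $\bot$ and variables in $Var$ with $\land,\lor,\rightarrow$. An intermediate logic is a set $\mathbf{L}\subsetneq\mathcal{L}_0$ containing all instances of the schemes $\phi\to(\psi\to\phi)$; $(\phi\to(\chi\to\psi))\to((\phi\to\chi)\to(\phi\to\psi))$; $(\phi\land\psi)\to\phi$; $(\phi\land\psi)\to\psi$; $\phi\to(\psi\to(\phi\land\psi))$; $\phi\to(\phi\lor\psi)$; $\psi\to(\phi\lor\psi)$; $(\phi\to\psi)\to((\chi\to\psi)\to((\phi\lor\chi)\to\psi))$; $\bot\to\phi$, and closed under modus ponens and under substitutions $Var\to\mathcal{L}_0$ (extended homomorphically). Justification terms: $t::=x\mid c\mid[t+t]\mid[t\cdot t]\mid\,!t$ with $x\in V=\{x_i\mid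 i\in\mathbb N\}$ (justification variables), $c\in C=\{c_i\mid i\in\mathbb N\}$ (constants); $Jt$ is the set of terms. $\mathcal{L}_J$: $\phi::=\bot\mid p\mid\phi\land\phi\mid\phi\lor\phi\mid\phi\to\phi\mid t:\phi$ ($p\in Var$, $t\in Jt$). $\overline{\mathbf{L}}$ is the set of all $\sigma(\psi)$ with $\psi\in\mathbf L$ and $\sigma:Var\to\mathcal{L}_J$ a substitution (extended by commuting with the connectives and with each $t:$). Schemes: $(J)$ $t:(\phi\to\psi)\to(s:\phi\to[t\cdot s]:\psi)$; $(+)$ $t:\phi\to[t+s]:\phi$ and $t:\phi\to[s+t]:\phi$; $(F)$ $t:\phi\to\phi$; $(I)$ $t:\phi\to\,!t:t:\phi$. $\mathbf{LJ}_0$ is the smallest subset of $\mathcal L_J$ containing $\overline{\mathbf L}$ and all instances of $(J),(+)$ and closed under modus ponens; $\mathbf{LJT}_0$ adds $(F)$, $\mathbf{LJ4}_0$ adds $(I)$, $\mathbf{LJT4}_0$ adds $(F)$ and $(I)$. A constant specification for $\mathbf{LJL}_0$ is a set $CS$ of formulas $c_{i_n}:\dots:c_{i_1}:\phi$ ($n\ge1$, $c_{i_k}\in C$) where $\phi\in\overline{\mathbf L}$ or $\phi$ is an instance of one of the justification schemes included in $\mathbf{LJL}_0$. $\Gamma\vdash_{\mathbf{LJL}_{CS}}\phi$ means there are $\gamma_1,\dots,\gamma_n\in\Gamma\cup CS$ ($n\ge0$; for $n=0$ this means $\phi\in\mathbf{LJL}_0$) with $\bigwedge_i\gamma_i\to\phi\in\mathbf{LJL}_0$.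 Let $Var^\star:=Var\cup\{\phi_t\mid\phi\in\mathcal L_J,t\in Jt\}$, where the $\phi_t$ are new pairwise distinct propositional variables, and $\mathcal{L}_0^\star$ the propositional language over $Var^\star$. $\mathbf L^\star:=b[\mathbf L]$ for a bijection $b:Var\to Var^\star$ extended homomorphically (independent of the choice of $b$). For $\Gamma\cup\{\phi\}\subseteq\mathcal L_0^\star$, $\Gamma\vdash_{\mathbf L^\star}\phi$ iff there are $\gamma_1,\dots,\gamma_n\in\Gamma$ ($n\ge 0$) with $\bigwedge_i\gamma_i\to\phi\in\mathbf L^\star$. The translation $\star:\mathcal L_J\to\mathcal L_0^\star$ is defined by $\bot^\star=\bot$, $p^\star=p$, $(\phi\circ\psi)^\star=\phi^\star\circ\psi^\star$ for $\circ\in\{\land,\lor,\to\}$, $(t:\phi)^\star=\phi_t$; for a set $\Delta$, $\Delta^\star=\{\delta^\star\mid\delta\in\Delta\}$. -}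

module Defs where

open import Data.Nat using (ℕ)
open import Data.Bool using (Bool; true; false)
open import Data.List using (List; []; _∷_)
open import Data.List.Relation.Unary.All using (All)
open import Data.Product using (Σ; _×_; ∃)
open import Data.Sum using (_⊎_)
open import Relation.Nullary using (¬_)
open import Relation.Binary.PropositionalEquality using (_≡_)
open import Function.Bundles using (_⤖_; Bijection)

infixr 6 _∧_
infixr 5 _∨_
infixr 4 _⇒_

data Prop (A : Set) : Set where
  ⊥' : Prop A
  var : A → Prop A
  _∧_ : Prop A → Prop A → Prop A
  _∨_ : Prop A → Prop A → Prop A
  _⇒_ : Prop A → Prop A → Prop A

ℒ₀ : Set
ℒ₀ = Prop ℕ

substP : {A B : Set} → (A → Prop B) → Prop A → Prop B
substP σ ⊥' = ⊥'
substP σ (var p) = σ p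
substP σ (φ ∧ ψ) = substP σ φ ∧ substP σ ψ
substP σ (φ ∨ ψ) = substP σ φ ∨ substP σ ψ
substP σ (φ ⇒ ψ) = substP σ φ ⇒ substP σ ψ

renameP : {A B : Set} → (A → B) → Prop A → Prop B
renameP f = substP (λ a → var (f a))

data IntAx {A : Set} : Prop A → Set where
  ax1 : ∀ φ ψ → IntAx (φ ⇒ (ψ ⇒ φ))
  ax2 : ∀ φ χ ψ → IntAx ((φ ⇒ (χ ⇒ ψ)) ⇒ ((φ ⇒ χ) ⇒ (φ ⇒ ψ)))
  ax3 : ∀ φ ψ → IntAx ((φ ∧ ψ) ⇒ φ)
  ax4 : ∀ φ ψ → IntAx ((φ ∧ ψ) ⇒ ψ)
  ax5 : ∀ φ ψ → IntAx (φ ⇒ (ψ ⇒ (φ ∧ ψ)))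
  ax6 : ∀ φ ψ → IntAx (φ ⇒ (φ ∨ ψ))
  ax7 : ∀ φ ψ → IntAx (ψ ⇒ (φ ∨ ψ))
  ax8 : ∀ φ ψ χ → IntAx ((φ ⇒ ψ) ⇒ ((χ ⇒ ψ) ⇒ ((φ ∨ χ) ⇒ ψ)))
  ax9 : ∀ φ → IntAx (⊥' ⇒ φ)

record IntermediateLogic (L : ℒ₀ → Set) : Set where
  field
    proper  : ∃ λ φ → ¬ L φ
    axioms  : ∀ {φ} → IntAx φ → L φ
    mp      : ∀ {φ ψ} → L (φ ⇒ ψ) → L φ → L ψ
    subst   : ∀ (σ : ℕ → ℒ₀) {φ} → L φ → L (substP σ φ)

infixl 7 _·_
infixl 6 _+'_

data Jt : Set where
  jvar  : ℕ → Jt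
  const : ℕ → Jt
  _+'_  : Jt → Jt → Jt
  _·_   : Jt → Jt → Jt
  !_    : Jt → Jt

infixr 6 _∧J_
infixr 5 _∨J_
infixr 4 _⇒J_
infix 8 _∶_

data ℒJ : Set where
  ⊥J   : ℒJ
  varJ : ℕ → ℒJ
  _∧J_ : ℒJ → ℒJ → ℒJ
  _∨J_ : ℒJ → ℒJ → ℒJ
  _⇒J_ : ℒJ → ℒJ → ℒJ
  _∶_  : Jt → ℒJ → ℒJ

substJ : (ℕ → ℒJ) → ℒ₀ → ℒJ
substJ σ ⊥' = ⊥J
substJ σ (var p) = σ p
substJ σ (φ ∧ ψ) = substJ σ φ ∧J substJ σ ψ
substJ σ (φ ∨ ψ) = substJ σ φ ∨J substJ σ ψ
substJ σ (φ ⇒ ψ) = substJ σ φ ⇒J substJ σ ψ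

Lbar : (ℒ₀ → Set) → ℒJ → Set
Lbar L φ = Σ ℒ₀ λ ψ → Σ (ℕ → ℒJ) λ σ → L ψ × substJ σ ψ ≡ φ

data Variant : Set where
  J JT J4 JT4 : Variant

hasF : Variant → Bool
hasF J = false
hasF JT = true
hasF J4 = false
hasF JT4 = true

hasI : Variant → Bool
hasI J = false
hasI JT = false
hasI J4 = true
hasI JT4 = true

data JustAx (v : Variant) : ℒJ → Set where
  axJ  : ∀ t s φ ψ → JustAx v (t ∶ (φ ⇒J ψ) ⇒J (s ∶ φ ⇒J (t · s) ∶ ψ))
  ax+l : ∀ t s φ → JustAx v (t ∶ φ ⇒J (t +' s) ∶ φ)
  ax+r : ∀ t s φ → JustAx v (t ∶ φ ⇒J (s +' t) ∶ φ)
  axF  : hasF v ≡ true → ∀ t φ → JustAx v (t ∶ φ ⇒J φ)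
  axI  : hasI v ≡ true → ∀ t φ → JustAx v (t ∶ φ ⇒J (! t) ∶ (t ∶ φ))

data LJL₀ (L : ℒ₀ → Set) (v : Variant) : ℒJ → Set where
  lbar : ∀ {φ} → Lbar L φ → LJL₀ L v φ
  jax  : ∀ {φ} → JustAx v φ → LJL₀ L v φ
  mp   : ∀ {φ ψ} → LJL₀ L v (φ ⇒J ψ) → LJL₀ L v φ → LJL₀ L v ψ

data CSFormula (L : ℒ₀ → Set) (v : Variant) : ℒJ → Set where
  base : ∀ i {φ} → (Lbar L φ ⊎ JustAx v φ) → CSFormula L v (const i ∶ φ)
  step : ∀ i {φ} → CSFormula L v φ → CSFormula L v (const i ∶ φ)

IsConstSpec : (L : ℒ₀ → Set) → Variant → (ℒJ → Set) → Set
IsConstSpec L v CS = ∀ φ → CS φ → CSFormula L v φ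

conjJ : ℒJ → List ℒJ → ℒJ
conjJ γ [] = γ
conjJ γ (δ ∷ δs) = γ ∧J conjJ δ δs

conjImpJ : List ℒJ → ℒJ → ℒJ
conjImpJ [] φ = φ
conjImpJ (γ ∷ γs) φ = conjJ γ γs ⇒J φ

conjP : {A : Set} → Prop A → List (Prop A) → Prop A
conjP γ [] = γ
conjP γ (δ ∷ δs) = γ ∧ conjP δ δs

conjImpP : {A : Set} → List (Prop A) → Prop A → Prop A
conjImpP [] φ = φ
conjImpP (γ ∷ γs) φ = conjP γ γs ⇒ φ

Derives : (L : ℒ₀ → Set) → Variant → (CS : ℒJ → Set) → (Γ : ℒJ → Set) → ℒJ → Set
Derives L v CS Γ φ =
  Σ (List ℒJ) λ γs → All (λ γ → Γ γ ⊎ CS γ) γs × LJL₀ L v (conjImpJ γs φ)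

Th : (L : ℒ₀ → Set) → Variant → (CS : ℒJ → Set) → ℒJ → Set
Th L v CS ψ = Derives L v CS (λ _ → ⊥e) ψ
  where open import Data.Empty renaming (⊥ to ⊥e)

data Var⋆ : Set where
  orig : ℕ → Var⋆
  jv   : ℒJ → Jt → Var⋆

ℒ₀⋆ : Set
ℒ₀⋆ = Prop Var⋆

Lstar : (L : ℒ₀ → Set) → (ℕ ⤖ Var⋆) → ℒ₀⋆ → Set
Lstar L b ψ = Σ ℒ₀ λ χ → L χ × renameP (Bijection.to b) χ ≡ ψ

DerivesStar : (L : ℒ₀ → Set) → (ℕ ⤖ Var⋆) → (ℒ₀⋆ → Set) → ℒ₀⋆ → Set
DerivesStar L b Γ φ =
  Σ (List ℒ₀⋆) λ γs → All Γ γs × Lstar L b (conjImpP γs φ)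

_⋆ : ℒJ → ℒ₀⋆
⊥J ⋆ = ⊥'
varJ p ⋆ = var (orig p)
(φ ∧J ψ) ⋆ = (φ ⋆) ∧ (ψ ⋆)
(φ ∨J ψ) ⋆ = (φ ⋆) ∨ (ψ ⋆)
(φ ⇒J ψ) ⋆ = (φ ⋆) ⇒ (ψ ⋆)
(t ∶ φ) ⋆ = var (jv φ t)

image⋆ : (ℒJ → Set) → ℒ₀⋆ → Set
image⋆ Δ χ = Σ ℒJ λ δ → Δ δ × (δ ⋆) ≡ χ

_∪_ : {A : Set} → (A → Set) → (A → Set) → A → Set
(P ∪ Q) a = P a ⊎ Q a

module Submission where

-- The translation ⋆ replaces every justification atom t:ψ by a fresh
-- propositional variable ψ_t.  It has a left inverse  unstar, which reads
-- ψ_t back as t:ψ and, being a homomorphism, commutes with substitutions.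
--
-- (⇒) If ⋀γs → φ ∈ LJL₀ with γs ⊆ Γ ∪ CS, then ⋀γs → φ is itself a theorem
--     of LJL_CS and so is every member of CS; hence the hypotheses
--     (⋀γs → φ)⋆, γs⋆ lie in Γ⋆ ∪ Th⋆ and φ⋆ follows from them by the
--     L⋆-theorem  ((A → φ⋆) ∧ A) → φ⋆.
-- (⇐) A theorem of L⋆ is a renaming of a theorem of L, so its unstar is a
--     substitution instance of it, i.e. lies in L̄ ⊆ LJL₀.  Unstarring the
--     hypotheses gives members of Γ or theorems of LJL_CS, and derivability
--     Γ ⊢_{LJL_CS} is closed under modus ponens, which closes the argument.

open import Defs
open import Data.Nat using (ℕ; zero; suc)
open import Data.Product using (_×_; _,_; proj₁; proj₂)
open import Data.Sum using (_⊎_; inj₁; inj₂)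
open import Data.List using (List; []; _∷_; _++_; map)
open import Data.List.Relation.Unary.All as All using (All; []; _∷_)
open import Data.List.Relation.Unary.All.Properties using (++⁺; map⁺)
open import Relation.Binary.PropositionalEquality
  using (_≡_; refl; sym; cong; cong₂; subst; module ≡-Reasoning)
open import Function.Bundles using (_⤖_; Bijection)

module Combinators {F : Set} (_⊃_ _&_ : F → F → F) (Provable : F → Set)
  (mp : ∀ {a b} → Provable (a ⊃ b) → Provable a → Provable b)
  (axK : ∀ a b → Provable (a ⊃ (b ⊃ a)))
  (axS : ∀ a b c → Provable ((a ⊃ (b ⊃ c)) ⊃ ((a ⊃ b) ⊃ (a ⊃ c))))
  (axFst : ∀ a b → Provable ((a & b) ⊃ a))
  (axSnd : ∀ a b → Provable ((a & b) ⊃ b))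
  (axPair : ∀ a b → Provable (a ⊃ (b ⊃ (a & b)))) where

  identity : ∀ a → Provable (a ⊃ a)
  identity a = mp (mp (axS a (a ⊃ a) a) (axK a (a ⊃ a))) (axK a a)

  weaken : ∀ {a b} → Provable b → Provable (a ⊃ b)
  weaken {a} {b} p = mp (axK b a) p

  mpUnder : ∀ {a b c} → Provable (a ⊃ (b ⊃ c)) → Provable (a ⊃ b) → Provable (a ⊃ c)
  mpUnder {a} {b} {c} p q = mp (mp (axS a b c) p) q

  compose : ∀ {a b c} → Provable (a ⊃ b) → Provable (b ⊃ c) → Provable (a ⊃ c)
  compose p q = mpUnder (weaken q) p

  pairUnder : ∀ {a b c} → Provable (a ⊃ b) → Provable (a ⊃ c) → Provable (a ⊃ (b & c))
  pairUnder {a} {b} {c} p q = mpUnder (compose p (axPair b c)) q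

  detach : ∀ a b → Provable (((a ⊃ b) & a) ⊃ b)
  detach a b = mpUnder (axFst (a ⊃ b) a) (axSnd (a ⊃ b) a)

module LogicCombinators {L : ℒ₀ → Set} (IL : IntermediateLogic L) =
  Combinators _⇒_ _∧_ L (IntermediateLogic.mp IL)
    (λ a b → IntermediateLogic.axioms IL (ax1 a b))
    (λ a b c → IntermediateLogic.axioms IL (ax2 a b c))
    (λ a b → IntermediateLogic.axioms IL (ax3 a b))
    (λ a b → IntermediateLogic.axioms IL (ax4 a b))
    (λ a b → IntermediateLogic.axioms IL (ax5 a b))

assign₃ : ℒJ → ℒJ → ℒJ → ℕ → ℒJ
assign₃ a b c zero = a
assign₃ a b c (suc zero) = b
assign₃ a b c (suc (suc zero)) = c
assign₃ a b c (suc (suc (suc _))) = ⊥J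

module JustificationLogic {L : ℒ₀ → Set} (IL : IntermediateLogic L) (v : Variant) where
  open IntermediateLogic IL using (axioms)

  instanceOf : ∀ {ψ} → L ψ → (σ : ℕ → ℒJ) → LJL₀ L v (substJ σ ψ)
  instanceOf {ψ} l σ = lbar (ψ , σ , l , refl)

  axK : ∀ a b → LJL₀ L v (a ⇒J (b ⇒J a))
  axK a b = instanceOf (axioms (ax1 (var 0) (var 1))) (assign₃ a b ⊥J)

  axS : ∀ a b c → LJL₀ L v ((a ⇒J (b ⇒J c)) ⇒J ((a ⇒J b) ⇒J (a ⇒J c)))
  axS a b c = instanceOf (axioms (ax2 (var 0) (var 1) (var 2))) (assign₃ a b c)

  axFst : ∀ a b → LJL₀ L v ((a ∧J b) ⇒J a)
  axFst a b = instanceOf (axioms (ax3 (var 0) (var 1))) (assign₃ a b ⊥J)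

  axSnd : ∀ a b → LJL₀ L v ((a ∧J b) ⇒J b)
  axSnd a b = instanceOf (axioms (ax4 (var 0) (var 1))) (assign₃ a b ⊥J)

  axPair : ∀ a b → LJL₀ L v (a ⇒J (b ⇒J (a ∧J b)))
  axPair a b = instanceOf (axioms (ax5 (var 0) (var 1))) (assign₃ a b ⊥J)

  open Combinators _⇒J_ _∧J_ (LJL₀ L v) mp axK axS axFst axSnd axPair public

  -- Conjunction of a list with ⊤ := ⊥ → ⊥ as the empty conjunction; unlike
  -- conjJ it is defined for every list and behaves well under _++_.
  ⊤J : ℒJ
  ⊤J = ⊥J ⇒J ⊥J

  ⋀ : List ℒJ → ℒJ
  ⋀ [] = ⊤J
  ⋀ (γ ∷ γs) = γ ∧J ⋀ γs

  ⋀⇒conjJ : ∀ γ γs → LJL₀ L v (⋀ (γ ∷ γs) ⇒J conjJ γ γs)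
  ⋀⇒conjJ γ [] = axFst _ _
  ⋀⇒conjJ γ (δ ∷ δs) = pairUnder (axFst _ _) (compose (axSnd _ _) (⋀⇒conjJ δ δs))

  conjJ⇒⋀ : ∀ γ γs → LJL₀ L v (conjJ γ γs ⇒J ⋀ (γ ∷ γs))
  conjJ⇒⋀ γ [] = pairUnder (identity γ) (weaken (identity ⊥J))
  conjJ⇒⋀ γ (δ ∷ δs) = pairUnder (axFst _ _) (compose (axSnd _ _) (conjJ⇒⋀ δ δs))

  conjImp⇒⋀ : ∀ γs {φ} → LJL₀ L v (conjImpJ γs φ) → LJL₀ L v (⋀ γs ⇒J φ)
  conjImp⇒⋀ [] p = weaken p
  conjImp⇒⋀ (γ ∷ γs) p = compose (⋀⇒conjJ γ γs) p

  ⋀⇒conjImp : ∀ γs {φ} → LJL₀ L v (⋀ γs ⇒J φ) → LJL₀ L v (conjImpJ γs φ)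
  ⋀⇒conjImp [] p = mp p (identity ⊥J)
  ⋀⇒conjImp (γ ∷ γs) p = compose (conjJ⇒⋀ γ γs) p

  ⋀-++ˡ : ∀ xs ys → LJL₀ L v (⋀ (xs ++ ys) ⇒J ⋀ xs)
  ⋀-++ˡ [] ys = weaken (identity ⊥J)
  ⋀-++ˡ (x ∷ xs) ys = pairUnder (axFst _ _) (compose (axSnd _ _) (⋀-++ˡ xs ys))

  ⋀-++ʳ : ∀ xs ys → LJL₀ L v (⋀ (xs ++ ys) ⇒J ⋀ ys)
  ⋀-++ʳ [] ys = identity _
  ⋀-++ʳ (x ∷ xs) ys = compose (axSnd _ _) (⋀-++ʳ xs ys)

module Derivability {L : ℒ₀ → Set} (IL : IntermediateLogic L) (v : Variant)
  (CS Γ : ℒJ → Set) where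
  open JustificationLogic IL v

  ⊢_ : ℒJ → Set
  ⊢_ = Derives L v CS Γ

  fromTheorem : ∀ {φ} → LJL₀ L v φ → ⊢ φ
  fromTheorem p = [] , [] , p

  fromHypothesis : ∀ {φ} → Γ φ ⊎ CS φ → ⊢ φ
  fromHypothesis {φ} h = φ ∷ [] , h ∷ [] , identity φ

  fromTh : ∀ {φ} → Th L v CS φ → ⊢ φ
  fromTh (γs , hs , p) = γs , All.map (λ { (inj₂ c) → inj₂ c }) hs , p

  -- modus ponens: concatenate the hypothesis lists
  mp⊢ : ∀ {a b} → ⊢ (a ⇒J b) → ⊢ a → ⊢ b
  mp⊢ {a} {b} (xs , hx , p) (ys , hy , q) =
    xs ++ ys , ++⁺ hx hy ,
    ⋀⇒conjImp (xs ++ ys)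
      (mpUnder (compose (⋀-++ˡ xs ys) (conjImp⇒⋀ xs p))
               (compose (⋀-++ʳ xs ys) (conjImp⇒⋀ ys q)))

  conj⊢ : ∀ δ δs → All ⊢_ (δ ∷ δs) → ⊢ conjJ δ δs
  conj⊢ δ [] (d ∷ []) = d
  conj⊢ δ (δ' ∷ δs) (d ∷ ds) = mp⊢ (mp⊢ (fromTheorem (axPair _ _)) d) (conj⊢ δ' δs ds)

  cut : ∀ δs {φ} → All ⊢_ δs → LJL₀ L v (conjImpJ δs φ) → ⊢ φ
  cut [] _ p = fromTheorem p
  cut (δ ∷ δs) ds p = mp⊢ (fromTheorem p) (conj⊢ δ δs ds)

⋆-conjImp : ∀ γs φ → (conjImpJ γs φ) ⋆ ≡ conjImpP (map _⋆ γs) (φ ⋆)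
⋆-conjImp [] φ = refl
⋆-conjImp (γ ∷ γs) φ = cong (_⇒ (φ ⋆)) (⋆-conj γ γs)
  where
  ⋆-conj : ∀ γ γs → (conjJ γ γs) ⋆ ≡ conjP (γ ⋆) (map _⋆ γs)
  ⋆-conj γ [] = refl
  ⋆-conj γ (δ ∷ δs) = cong ((γ ⋆) ∧_) (⋆-conj δ δs)

unstarVar : Var⋆ → ℒJ
unstarVar (orig p) = varJ p
unstarVar (jv ψ t) = t ∶ ψ

unstar : ℒ₀⋆ → ℒJ
unstar ⊥' = ⊥J
unstar (var x) = unstarVar x
unstar (ψ ∧ χ) = unstar ψ ∧J unstar χ
unstar (ψ ∨ χ) = unstar ψ ∨J unstar χ
unstar (ψ ⇒ χ) = unstar ψ ⇒J unstar χ

unstar-⋆ : ∀ φ → unstar (φ ⋆) ≡ φ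
unstar-⋆ ⊥J = refl
unstar-⋆ (varJ p) = refl
unstar-⋆ (φ ∧J ψ) = cong₂ _∧J_ (unstar-⋆ φ) (unstar-⋆ ψ)
unstar-⋆ (φ ∨J ψ) = cong₂ _∨J_ (unstar-⋆ φ) (unstar-⋆ ψ)
unstar-⋆ (φ ⇒J ψ) = cong₂ _⇒J_ (unstar-⋆ φ) (unstar-⋆ ψ)
unstar-⋆ (t ∶ φ) = refl

unstar-substP : ∀ (σ : ℕ → ℒ₀⋆) χ
  → unstar (substP σ χ) ≡ substJ (λ n → unstar (σ n)) χ
unstar-substP σ ⊥' = refl
unstar-substP σ (var p) = refl
unstar-substP σ (χ ∧ ψ) = cong₂ _∧J_ (unstar-substP σ χ) (unstar-substP σ ψ)
unstar-substP σ (χ ∨ ψ) = cong₂ _∨J_ (unstar-substP σ χ) (unstar-substP σ ψ)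
unstar-substP σ (χ ⇒ ψ) = cong₂ _⇒J_ (unstar-substP σ χ) (unstar-substP σ ψ)

unstar-conjImp : ∀ γs φ → unstar (conjImpP γs φ) ≡ conjImpJ (map unstar γs) (unstar φ)
unstar-conjImp [] φ = refl
unstar-conjImp (γ ∷ γs) φ = cong (_⇒J unstar φ) (unstar-conj γ γs)
  where
  unstar-conj : ∀ γ γs → unstar (conjP γ γs) ≡ conjJ (unstar γ) (map unstar γs)
  unstar-conj γ [] = refl
  unstar-conj γ (δ ∷ δs) = cong (unstar γ ∧J_) (unstar-conj δ δs)

Lstar⇒Lbar : ∀ {L b ψ} → Lstar L b ψ → Lbar L (unstar ψ)
Lstar⇒Lbar {b = b} (χ , l , refl) =
  χ , (λ n → unstarVar (Bijection.to b n)) , l ,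
  sym (unstar-substP (λ n → var (Bijection.to b n)) χ)

renameP-inverse : ∀ {A B : Set} (f : B → A) (g : A → B) → (∀ a → f (g a) ≡ a)
  → ∀ ψ → renameP f (renameP g ψ) ≡ ψ
renameP-inverse f g fg ⊥' = refl
renameP-inverse f g fg (var a) = cong var (fg a)
renameP-inverse f g fg (ψ ∧ χ) = cong₂ _∧_ (renameP-inverse f g fg ψ) (renameP-inverse f g fg χ)
renameP-inverse f g fg (ψ ∨ χ) = cong₂ _∨_ (renameP-inverse f g fg ψ) (renameP-inverse f g fg χ)
renameP-inverse f g fg (ψ ⇒ χ) = cong₂ _⇒_ (renameP-inverse f g fg ψ) (renameP-inverse f g fg χ)

module StarLogic {L : ℒ₀ → Set} (IL : IntermediateLogic L) (b : ℕ ⤖ Var⋆) where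
  open LogicCombinators IL

  b⁻¹ : Var⋆ → ℕ
  b⁻¹ y = proj₁ (Bijection.strictlySurjective b y)

  pullback : ∀ {ψ} → L (renameP b⁻¹ ψ) → Lstar L b ψ
  pullback {ψ} l = renameP b⁻¹ ψ , l ,
    renameP-inverse (Bijection.to b) b⁻¹
      (λ y → proj₂ (Bijection.strictlySurjective b y)) ψ

  detach⋆ : ∀ ys φ → Lstar L b (conjImpP (conjImpP ys φ ∷ ys) φ)
  detach⋆ [] φ = pullback (identity _)
  detach⋆ (y ∷ ys) φ = pullback (detach _ _)

module Translation {L : ℒ₀ → Set} (IL : IntermediateLogic L) (v : Variant)
  (CS : ℒJ → Set) (b : ℕ ⤖ Var⋆) (Γ : ℒJ → Set) where
  open JustificationLogic IL v using (identity)
  open Derivability IL v CS Γ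
  open StarLogic IL b

  Hyp⋆ : ℒ₀⋆ → Set
  Hyp⋆ = image⋆ Γ ∪ image⋆ (Th L v CS)

  hypothesis⋆ : ∀ {γ} → Γ γ ⊎ CS γ → Hyp⋆ (γ ⋆)
  hypothesis⋆ {γ} (inj₁ g) = inj₁ (γ , g , refl)
  hypothesis⋆ {γ} (inj₂ c) = inj₂ (γ , (γ ∷ [] , inj₂ c ∷ [] , identity γ) , refl)

  unstarHypothesis : ∀ {χ} → Hyp⋆ χ → ⊢ unstar χ
  unstarHypothesis (inj₁ (δ , g , refl)) =
    subst ⊢_ (sym (unstar-⋆ δ)) (fromHypothesis (inj₁ g))
  unstarHypothesis (inj₂ (δ , th , refl)) = subst ⊢_ (sym (unstar-⋆ δ)) (fromTh th)

  -- use the hypotheses (⋀γs → φ)⋆ ∈ Th⋆ and γs⋆, and detach φ⋆ in L⋆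
  forward : ∀ {φ} → ⊢ φ → DerivesStar L b Hyp⋆ (φ ⋆)
  forward {φ} (γs , hs , p) =
    (conjImpJ γs φ) ⋆ ∷ map _⋆ γs ,
    inj₂ (conjImpJ γs φ , ([] , [] , p) , refl) ∷ map⁺ (All.map hypothesis⋆ hs) ,
    subst (Lstar L b) (cong (λ A → conjImpP (A ∷ map _⋆ γs) (φ ⋆)) (sym (⋆-conjImp γs φ)))
      (detach⋆ (map _⋆ γs) (φ ⋆))

  -- the unstarred L⋆-theorem lies in L̄; cut the unstarred hypotheses into it
  backward : ∀ {φ} → DerivesStar L b Hyp⋆ (φ ⋆) → ⊢ φ
  backward {φ} (χs , hs , l) =
    cut (map unstar χs) (map⁺ (All.map unstarHypothesis hs))
        (lbar (subst (Lbar L) unstarred (Lstar⇒Lbar {b = b} l)))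
    where
    open ≡-Reasoning
    unstarred : unstar (conjImpP χs (φ ⋆)) ≡ conjImpJ (map unstar χs) φ
    unstarred = begin
      unstar (conjImpP χs (φ ⋆))
        ≡⟨ unstar-conjImp χs (φ ⋆) ⟩
      conjImpJ (map unstar χs) (unstar (φ ⋆))
        ≡⟨ cong (conjImpJ (map unstar χs)) (unstar-⋆ φ) ⟩
      conjImpJ (map unstar χs) φ
        ∎

mainTheorem1 : (L : ℒ₀ → Set) → IntermediateLogic L → (v : Variant)
    → (CS : ℒJ → Set) → IsConstSpec L v CS → (b : ℕ ⤖ Var⋆)
    → (Γ : ℒJ → Set) → (φ : ℒJ)
    → (Derives L v CS Γ φ → DerivesStar L b (image⋆ Γ ∪ image⋆ (Th L v CS)) (φ ⋆))
      × (DerivesStar L b (image⋆ Γ ∪ image⋆ (Th L v CS)) (φ ⋆) → Derives L v CS Γ φ)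
-- The argument needs no property of the constant specification.
mainTheorem1 L IL v CS _ b Γ φ = forward , backward
  where open Translation IL v CS b Γ
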